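{- Let $p>3$ be a prime, $n=2m$ with $m\ge2$, $q=p^n$, and let $s$ be an integer with $0\le s\le m-2$, $r=m-2-s$. Let $d=D(t,u_1,\dots,u_s)$ with $t,u_1,\dots,u_s\in\{0,\dots,p-1\}$, $t\neq0$, such that $t\notin\{1,p-1\}$ or $u_j\notin\{0,1,p-2,p-1\}$ for some $j\in\{1,\dots,s\}$. Then there exists $e\in\{1,\dots,p^n-1\}$ such that $s_p(e\star d)-s_p(e)>m(p-1)$.
   Context: $(d_0,\dots,d_{n-1})_p$ denotes $\sum_{i=0}^{n-1}d_ip^i$ for digits in $\{0,\dots,p-1\}$ not all equal to $p-1$; $\bar x=p-1-x$. $D(t,u_1,\dots,u_s)=(\underbrace{0,\dots,0}_{r},t,u_1,\dots,u_s,1,\underbrace{0,\dots,0}_{r},p-t,\bar u_1,\dots,\bar u_s,0)_p$. $s_p(e)$ is the base-$p$ digit sum of $e$. The operation $\star$ on $\{0,\dots,q-1\}$: $e\star d=0$ if $0\in\{e,d\}$; otherwise, with $r'$ the unique integer in $[0,q-1)$ congruent to $ed$ modulo $q-1$, $e\star d=q-1$ if $r'=0$ and $e\star d=r'$ otherwise. -}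

module Defs where

open import Data.Nat using (ℕ; zero; suc; _+_; _*_; _∸_; _^_; _≡ᵇ_)
open import Data.Nat.DivMod using (_/_; _%_)
open import Data.Bool using (if_then_else_)
open import Data.List using (List; []; _∷_; _++_; replicate; map)

fromDigits : ℕ → List ℕ → ℕ
fromDigits p []       = 0
fromDigits p (d ∷ ds) = d + p * fromDigits p ds

-- digit sum of e in base (suc (suc b)), with fuel (fuel e suffices)
digitSumFuel : ℕ → ℕ → ℕ → ℕ
digitSumFuel b zero       e = 0
digitSumFuel b (suc fuel) zero = 0
digitSumFuel b (suc fuel) (suc e) =
  (suc e % suc (suc b)) + digitSumFuel b fuel (suc e / suc (suc b))

-- s_p(e): base-p digit sum (meaningful for p ≥ 2; unused otherwise)
sp : ℕ → ℕ → ℕ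
sp (suc (suc b)) e = digitSumFuel b e e
sp _ e = 0

star : ℕ → ℕ → ℕ → ℕ
star q zero d = 0
star q (suc e) zero = 0
star q (suc e) (suc d) with q ∸ 1
... | zero = 0
... | suc k = let r' = (suc e * suc d) % suc k in
              if r' ≡ᵇ 0 then suc k else r'

-- D(t,u₁,…,u_s) with r leading zeros, digits listed from d₀ upward
Ddigits : ℕ → ℕ → ℕ → List ℕ → List ℕ
Ddigits p r t us =
  replicate r 0 ++ (t ∷ us) ++ (1 ∷ replicate r 0) ++
  ((p ∸ t) ∷ map (λ u → p ∸ 1 ∸ u) us) ++ (0 ∷ [])

D : ℕ → ℕ → ℕ → List ℕ → ℕ
D p r t us = fromDigits p (Ddigits p r t us)

{-# OPTIONS --safe #-}
module Submission where

-- Put a = p^r, c = p^(r+s+1) and M = p^m, so that q = M².  Read in blocks, D = X + c + M·Y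
-- with X = a(t + pU) and Y = a(p - t + pŪ), where U and Ū have the digits u and p - 1 - u;
-- hence X + Y = c and (1 + M)·D ≡ 2c(1 + M) modulo q - 1.  In each case below we write down e
-- with s_p(e) = (r + 1)(p - 1) + 1 and a number N < q - 1 with e·D ≡ N (mod q - 1), so that
-- e ⋆ D = N, and read s_p(N) = s_p(e) + m(p - 1) + 1 off the digits of N.
--  * t ∉ {1, p - 1}: e = pa(1 + M) - 1 and N = (q - 1 - D) + 2a(1 + M), the complement of D
--    with 2 added to its digits p - 1 - t and t - 1, which stay below p as 2 ≤ t ≤ p - 2.
--  * 2 ≤ u_j ≤ p - 3 and p = 2H + 1: with α the number with digits H^r, 0, δ_j and
--    A = α + c(H - 1), e = 1 + (1 + M)(H - 1 + pα) and N = D + 2A(1 + M), where adding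
--    2A(1 + M) to D causes no carries.

open import Defs
open import Data.Fin as Fin using (Fin)
open import Data.List using (List; []; _∷_; _++_; replicate; map; tabulate; length)
open import Data.List.Properties using (length-++; length-replicate; length-map; length-tabulate; map-++; map-tabulate; map-replicate)
open import Data.List.Relation.Unary.All using (All; []; _∷_; universal)
open import Data.List.Relation.Unary.All.Properties using (++⁺; tabulate⁺; replicate⁺; map⁺)
open import Data.Nat using (ℕ; zero; suc; _+_; _*_; _∸_; _^_; _≤_; _<_; z≤n; s≤s; NonZero; >-nonZero; ≢-nonZero⁻¹)
open import Data.Nat.DivMod using (_/_; _%_; [m+kn]%n≡m%n; m<n⇒m%n≡m; m*n%n≡0; +-distrib-/; m<n⇒m/n≡0; m*n/n≡m; m/n<m; m≡m%n+[m/n]*n; m%n<n)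
open import Data.Nat.Divisibility using (divides)
open import Data.Nat.ListAction using (sum)
open import Data.Nat.ListAction.Properties using (sum-++)
open import Data.Nat.Primality using (Prime; prime⇒irreducible)
open import Data.Nat.Properties
open import Algebra.Properties.CommutativeSemigroup +-commutativeSemigroup using (xy∙z≈xz∙y)
open import Data.Nat.Tactic.RingSolver using (solve-∀)
open import Data.Product using (_×_; _,_; ∃-syntax)
open import Data.Sum using (_⊎_; inj₁; inj₂)
open import Relation.Binary.PropositionalEquality
open import Relation.Nullary using (contradiction)
open import Function using (_∘_)

x≢0∧x≢1⇒2≤x : ∀ {x} → x ≢ 0 → x ≢ 1 → 2 ≤ x
x≢0∧x≢1⇒2≤x {zero}          x≢0 _   = contradiction refl x≢0
x≢0∧x≢1⇒2≤x {suc zero}      _   x≢1 = contradiction refl x≢1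
x≢0∧x≢1⇒2≤x {suc (suc _)}   _   _   = s≤s (s≤s z≤n)

x+[1+k]≤p : ∀ {x p} k → x + k ≤ p → x ≢ p ∸ k → x + suc k ≤ p
x+[1+k]≤p {x} {p} k x+k≤p x≢p∸k = subst (_≤ p) (sym (+-suc x k)) (≤∧≢⇒< x+k≤p x+k≢p)
  where
  x+k≢p : x + k ≢ p
  x+k≢p eq = x≢p∸k (trans (sym (m+n∸n≡m x k)) (cong (_∸ k) eq))

m∸2∸s+2≤m : ∀ {m} s → s + 2 ≤ m → m ∸ 2 ∸ s + 2 ≤ m
m∸2∸s+2≤m {m} s s+2≤m = ≤-trans (+-monoˡ-≤ 2 (m∸n≤m (m ∸ 2) s)) (≤-reflexive (m∸n+n≡m (m+n≤o⇒n≤o s s+2≤m)))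

complement : ℕ → ℕ → ℕ
complement p x = p ∸ 1 ∸ x

sum-replicate : ∀ k x → sum (replicate k x) ≡ k * x
sum-replicate zero    x = refl
sum-replicate (suc k) x = cong (x +_) (sum-replicate k x)

complement<p : ∀ p .{{_ : NonZero p}} x → complement p x < p
complement<p (suc p) x = s≤s (m∸n≤m p x)

complement+2<p : ∀ {p x} → 2 ≤ x → x < p → complement p x + 2 < p
complement+2<p {suc p} {suc zero} (s≤s ())
complement+2<p {suc p} {suc (suc x)} _ x<p = s≤s (begin
  p ∸ (2 + x) + 2       ≤⟨ +-monoʳ-≤ (p ∸ (2 + x)) (m≤m+n 2 x) ⟩
  p ∸ (2 + x) + (2 + x) ≡⟨ m∸n+n≡m (≤-pred x<p) ⟩
  p ∎)
  where open ≤-Reasoning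

sum-complement : ∀ p {xs} → All (_< p) xs → sum (map (complement p) xs) + sum xs ≡ length xs * (p ∸ 1)
sum-complement p []                     = refl
sum-complement p {x ∷ xs} (x<p ∷ xs<p) = begin
  (p ∸ 1 ∸ x + sum (map (complement p) xs)) + (x + sum xs)
    ≡⟨ shuffle (p ∸ 1 ∸ x) x _ _ ⟩
  (p ∸ 1 ∸ x + x) + (sum (map (complement p) xs) + sum xs)
    ≡⟨ cong₂ _+_ (m∸n+n≡m (<⇒≤pred x<p)) (sum-complement p xs<p) ⟩
  (p ∸ 1) + length xs * (p ∸ 1) ∎
  where
  open ≡-Reasoning
  shuffle : ∀ a b c d → (a + c) + (b + d) ≡ (a + b) + (c + d)
  shuffle = solve-∀

module _ (p : ℕ) where

  fromDigits-++ : ∀ xs ys → fromDigits p (xs ++ ys) ≡ fromDigits p xs + p ^ length xs * fromDigits p ys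
  fromDigits-++ []       ys = sym (+-identityʳ _)
  fromDigits-++ (x ∷ xs) ys = trans (cong (λ z → x + p * z) (fromDigits-++ xs ys)) (distrib p x (fromDigits p xs) _ _)
    where
    distrib : ∀ p x f w g → x + p * (f + w * g) ≡ (x + p * f) + (p * w) * g
    distrib = solve-∀

  fromDigits-replicate-0 : ∀ k → fromDigits p (replicate k 0) ≡ 0
  fromDigits-replicate-0 zero    = refl
  fromDigits-replicate-0 (suc k) = trans (cong (p *_) (fromDigits-replicate-0 k)) (*-zeroʳ p)

  fromDigits-replicate-0-++ : ∀ k xs → fromDigits p (replicate k 0 ++ xs) ≡ p ^ k * fromDigits p xs
  fromDigits-replicate-0-++ zero    xs = sym (*-identityˡ (fromDigits p xs))
  fromDigits-replicate-0-++ (suc k) xs = trans (cong (p *_) (fromDigits-replicate-0-++ k xs)) (sym (*-assoc p (p ^ k) _))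

  fromDigits-replicate-+ : ∀ k x y → fromDigits p (replicate k (x + y)) ≡ fromDigits p (replicate k x) + fromDigits p (replicate k y)
  fromDigits-replicate-+ zero    x y = refl
  fromDigits-replicate-+ (suc k) x y = trans (cong (λ z → x + y + p * z) (fromDigits-replicate-+ k x y)) (distrib p x y _ _)
    where
    distrib : ∀ p x y f g → x + y + p * (f + g) ≡ (x + p * f) + (y + p * g)
    distrib = solve-∀

  fromDigits-replicate-max : .{{NonZero p}} → ∀ k → fromDigits p (replicate k (p ∸ 1)) + 1 ≡ p ^ k
  fromDigits-replicate-max zero    = refl
  fromDigits-replicate-max (suc k) = begin
    p ∸ 1 + p * F + 1   ≡⟨ regroup p (p ∸ 1) F ⟩
    p ∸ 1 + 1 + p * F   ≡⟨ cong (_+ p * F) (m∸n+n≡m (n≢0⇒n>0 (≢-nonZero⁻¹ p))) ⟩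
    p + p * F           ≡⟨ sym (*-suc p F) ⟩
    p * suc F           ≡⟨ cong (p *_) (trans (+-comm 1 F) (fromDigits-replicate-max k)) ⟩
    p * p ^ k ∎
    where
    open ≡-Reasoning
    F : ℕ
    F = fromDigits p (replicate k (p ∸ 1))
    regroup : ∀ p x F → x + p * F + 1 ≡ x + 1 + p * F
    regroup = solve-∀

  fromDigits-complement : ∀ {xs} → All (_< p) xs → fromDigits p (map (complement p) xs) + fromDigits p xs + 1 ≡ p ^ length xs
  fromDigits-complement []                     = refl
  fromDigits-complement {x ∷ xs} (x<p ∷ xs<p) = begin
    (p ∸ 1 ∸ x + p * C) + (x + p * F) + 1 ≡⟨ shuffle p (p ∸ 1 ∸ x) x C F ⟩
    (p ∸ 1 ∸ x + x) + 1 + p * (C + F)     ≡⟨ cong (λ z → z + 1 + p * (C + F)) (m∸n+n≡m (<⇒≤pred x<p)) ⟩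
    p ∸ 1 + 1 + p * (C + F)               ≡⟨ cong (_+ p * (C + F)) (m∸n+n≡m (n≢0⇒n>0 (m<n⇒n≢0 x<p))) ⟩
    p + p * (C + F)                       ≡⟨ sym (*-suc p (C + F)) ⟩
    p * suc (C + F)                       ≡⟨ cong (p *_) (+-comm 1 (C + F)) ⟩
    p * (C + F + 1)                       ≡⟨ cong (p *_) (fromDigits-complement xs<p) ⟩
    p * p ^ length xs ∎
    where
    open ≡-Reasoning
    C F : ℕ
    C = fromDigits p (map (complement p) xs)
    F = fromDigits p xs
    shuffle : ∀ p a b c f → (a + p * c) + (b + p * f) + 1 ≡ (a + b) + 1 + p * (c + f)
    shuffle = solve-∀

  fromDigits-< : ∀ {xs} → All (_< p) xs → fromDigits p xs < p ^ length xs
  fromDigits-< []                     = s≤s z≤n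
  fromDigits-< {x ∷ xs} (x<p ∷ xs<p) = begin
    suc x + p * fromDigits p xs ≤⟨ +-monoˡ-≤ (p * fromDigits p xs) x<p ⟩
    p + p * fromDigits p xs     ≡⟨ sym (*-suc p _) ⟩
    p * suc (fromDigits p xs)   ≤⟨ *-monoʳ-≤ p (fromDigits-< xs<p) ⟩
    p * p ^ length xs ∎
    where open ≤-Reasoning

  fromDigits≡0⇒sum≡0 : .{{NonZero p}} → ∀ xs → fromDigits p xs ≡ 0 → sum xs ≡ 0
  fromDigits≡0⇒sum≡0 []       _  = refl
  fromDigits≡0⇒sum≡0 (x ∷ xs) eq = cong₂ _+_ (m+n≡0⇒m≡0 x eq)
    (fromDigits≡0⇒sum≡0 xs (m*n≡0⇒m≡0 _ p (trans (*-comm _ p) (m+n≡0⇒n≡0 x eq))))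

fromDigits-tabulate-+* : ∀ p {n} (f g : Fin n → ℕ) k →
  fromDigits p (tabulate (λ i → f i + k * g i)) ≡ fromDigits p (tabulate f) + k * fromDigits p (tabulate g)
fromDigits-tabulate-+* p {zero}  f g k = sym (*-zeroʳ k)
fromDigits-tabulate-+* p {suc n} f g k =
  trans (cong (λ z → f Fin.zero + k * g Fin.zero + p * z) (fromDigits-tabulate-+* p (f ∘ Fin.suc) (g ∘ Fin.suc) k))
        (regroup p k (f Fin.zero) (g Fin.zero) _ _)
  where
  regroup : ∀ p k x y F G → (x + k * y) + p * (F + k * G) ≡ (x + p * F) + k * (y + p * G)
  regroup = solve-∀

sum-tabulate-+* : ∀ {n} (f g : Fin n → ℕ) k → sum (tabulate (λ i → f i + k * g i)) ≡ sum (tabulate f) + k * sum (tabulate g)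
sum-tabulate-+* {zero}  f g k = sym (*-zeroʳ k)
sum-tabulate-+* {suc n} f g k =
  trans (cong (f Fin.zero + k * g Fin.zero +_) (sum-tabulate-+* (f ∘ Fin.suc) (g ∘ Fin.suc) k))
        (regroup k (f Fin.zero) (g Fin.zero) _ _)
  where
  regroup : ∀ k x y F G → (x + k * y) + (F + k * G) ≡ (x + F) + k * (y + G)
  regroup = solve-∀

δ : ∀ {n} → Fin n → Fin n → ℕ
δ Fin.zero    Fin.zero    = 1
δ Fin.zero    (Fin.suc _) = 0
δ (Fin.suc _) Fin.zero    = 0
δ (Fin.suc j) (Fin.suc i) = δ j i

sum-tabulate-δ : ∀ {n} (j : Fin n) → sum (tabulate (δ j)) ≡ 1
sum-tabulate-δ {suc n} Fin.zero    = cong suc (sum-tabulate-0 n)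
  where
  sum-tabulate-0 : ∀ n → sum (tabulate {n = n} (λ _ → 0)) ≡ 0
  sum-tabulate-0 zero    = refl
  sum-tabulate-0 (suc n) = sum-tabulate-0 n
sum-tabulate-δ {suc n} (Fin.suc j) = sum-tabulate-δ j

δ≤1 : ∀ {n} (j i : Fin n) → δ j i ≤ 1
δ≤1 Fin.zero    Fin.zero    = ≤-refl
δ≤1 Fin.zero    (Fin.suc _) = z≤n
δ≤1 (Fin.suc _) Fin.zero    = z≤n
δ≤1 (Fin.suc j) (Fin.suc i) = δ≤1 j i

δ-cases : ∀ {n} (j i : Fin n) → δ j i ≡ 0 ⊎ (δ j i ≡ 1 × i ≡ j)
δ-cases Fin.zero    Fin.zero    = inj₂ (refl , refl)
δ-cases Fin.zero    (Fin.suc _) = inj₁ refl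
δ-cases (Fin.suc _) Fin.zero    = inj₁ refl
δ-cases (Fin.suc j) (Fin.suc i) with δ-cases j i
... | inj₁ δ≡0         = inj₁ δ≡0
... | inj₂ (δ≡1 , i≡j) = inj₂ (δ≡1 , cong Fin.suc i≡j)

+2δ<p : ∀ {n p} (f : Fin n → ℕ) (j i : Fin n) → f i < p → f j + 2 < p → f i + 2 * δ j i < p
+2δ<p f j i fi<p fj+2<p with δ-cases j i
... | inj₁ δ≡0          rewrite δ≡0 | +-identityʳ (f i) = fi<p
... | inj₂ (δ≡1 , refl) rewrite δ≡1 = fj+2<p

blocks : (r z x : ℕ) (xs : List ℕ) (w y : ℕ) (ys : List ℕ) (v : ℕ) → List ℕ
blocks r z x xs w y ys v = replicate r z ++ (x ∷ xs) ++ (w ∷ replicate r z) ++ (y ∷ ys) ++ (v ∷ [])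

module _ (r z x : ℕ) (xs : List ℕ) (w y : ℕ) (ys : List ℕ) (v : ℕ) where

  fromDigits-blocks : ∀ p → fromDigits p (blocks r z x xs w y ys v) ≡
    let Z = fromDigits p (replicate r z) in
    Z + p ^ r * ((x + p * fromDigits p xs) + p ^ suc (length xs) * ((w + p * Z) + p ^ suc r * ((y + p * fromDigits p ys) + p ^ suc (length ys) * v)))
  fromDigits-blocks p
    rewrite fromDigits-++ p (replicate r z) ((x ∷ xs) ++ (w ∷ replicate r z) ++ (y ∷ ys) ++ (v ∷ []))
          | fromDigits-++ p xs ((w ∷ replicate r z) ++ (y ∷ ys) ++ (v ∷ []))
          | fromDigits-++ p (replicate r z) ((y ∷ ys) ++ (v ∷ []))
          | fromDigits-++ p ys (v ∷ [])
          | length-replicate r {z}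
          | *-zeroʳ p | +-identityʳ v = regroup p (fromDigits p (replicate r z)) (p ^ r) x (fromDigits p xs) (p ^ length xs) w y (fromDigits p ys) (p ^ length ys) v
    where
    regroup : ∀ p Z a x X s w y Y t v →
      Z + a * (x + p * (X + s * (w + p * (Z + a * (y + p * (Y + t * v))))))
        ≡ Z + a * ((x + p * X) + p * s * ((w + p * Z) + p * a * ((y + p * Y) + p * t * v)))
    regroup = solve-∀

  sum-blocks : sum (blocks r z x xs w y ys v) ≡ r * z + ((x + sum xs) + ((w + r * z) + ((y + sum ys) + v)))
  sum-blocks
    rewrite sum-++ (replicate r z) ((x ∷ xs) ++ (w ∷ replicate r z) ++ (y ∷ ys) ++ (v ∷ []))
          | sum-++ xs ((w ∷ replicate r z) ++ (y ∷ ys) ++ (v ∷ []))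
          | sum-++ (replicate r z) ((y ∷ ys) ++ (v ∷ []))
          | sum-++ ys (v ∷ [])
          | sum-replicate r z | +-identityʳ v = regroup (r * z) x (sum xs) w y (sum ys) v
    where
    regroup : ∀ R x X w y Y v → R + (x + (X + (w + (R + (y + (Y + v)))))) ≡ R + ((x + X) + ((w + R) + ((y + Y) + v)))
    regroup = solve-∀

  length-blocks : length (blocks r z x xs w y ys v) ≡ r + (suc (length xs) + (suc r + (suc (length ys) + 1)))
  length-blocks
    rewrite length-++ (replicate r z) {(x ∷ xs) ++ (w ∷ replicate r z) ++ (y ∷ ys) ++ (v ∷ [])}
          | length-++ xs {(w ∷ replicate r z) ++ (y ∷ ys) ++ (v ∷ [])}
          | length-++ (replicate r z) {(y ∷ ys) ++ (v ∷ [])}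
          | length-++ ys {v ∷ []}
          | length-replicate r {z} = refl

  blocks⁺ : ∀ {P : ℕ → Set} → P z → P x → All P xs → P w → P y → All P ys → P v → All P (blocks r z x xs w y ys v)
  blocks⁺ Pz Px Pxs Pw Py Pys Pv =
    ++⁺ (replicate⁺ r Pz) (++⁺ (Px ∷ Pxs) (++⁺ (Pw ∷ replicate⁺ r Pz) (++⁺ (Py ∷ Pys) (Pv ∷ []))))

  map-blocks : ∀ (f : ℕ → ℕ) → map f (blocks r z x xs w y ys v) ≡ blocks r (f z) (f x) (map f xs) (f w) (f y) (map f ys) (f v)
  map-blocks f
    rewrite map-++ f (replicate r z) ((x ∷ xs) ++ (w ∷ replicate r z) ++ (y ∷ ys) ++ (v ∷ []))
          | map-++ f xs ((w ∷ replicate r z) ++ (y ∷ ys) ++ (v ∷ []))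
          | map-++ f (replicate r z) ((y ∷ ys) ++ (v ∷ []))
          | map-++ f ys (v ∷ [])
          | map-replicate f r z = refl

module _ (r z x : ℕ) (xs : List ℕ) (w y : ℕ) (ys : List ℕ) (v : ℕ) where

  fromDigits-blocks-bump : ∀ p k → fromDigits p (blocks r z (x + k) xs w (y + k) ys v) ≡
    fromDigits p (blocks r z x xs w y ys v) + k * (p ^ r + p ^ r * p ^ suc (length xs) * p ^ suc r)
  fromDigits-blocks-bump p k rewrite fromDigits-blocks r z (x + k) xs w (y + k) ys v p | fromDigits-blocks r z x xs w y ys v p =
    bump p k (fromDigits p (replicate r z)) (p ^ r) x (fromDigits p xs) (p ^ suc (length xs)) w (p ^ suc r) y (fromDigits p ys) (p ^ suc (length ys)) v
    where
    bump : ∀ p k Z a x X s w b y Y t v →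
      Z + a * ((x + k + p * X) + s * ((w + p * Z) + b * ((y + k + p * Y) + t * v)))
        ≡ Z + a * ((x + p * X) + s * ((w + p * Z) + b * ((y + p * Y) + t * v))) + k * (a + a * s * b)
    bump = solve-∀

  sum-blocks-bump : ∀ k → sum (blocks r z (x + k) xs w (y + k) ys v) ≡ sum (blocks r z x xs w y ys v) + (k + k)
  sum-blocks-bump k rewrite sum-blocks r z (x + k) xs w (y + k) ys v | sum-blocks r z x xs w y ys v =
    bump (r * z) x (sum xs) w y (sum ys) v k
    where
    bump : ∀ R x X w y Y v k → R + ((x + k + X) + ((w + R) + ((y + k + Y) + v))) ≡ R + ((x + X) + ((w + R) + ((y + Y) + v))) + (k + k)
    bump = solve-∀

module _ (b : ℕ) where
  private
    P : ℕ
    P = suc (suc b)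

  digitSumFuel-0 : ∀ fuel → digitSumFuel b fuel 0 ≡ 0
  digitSumFuel-0 zero    = refl
  digitSumFuel-0 (suc _) = refl

  digit-% : ∀ {x} v → x < P → (x + P * v) % P ≡ x
  digit-% {x} v x<P = begin
    (x + P * v) % P ≡⟨ cong (λ z → (x + z) % P) (*-comm P v) ⟩
    (x + v * P) % P ≡⟨ [m+kn]%n≡m%n x v P ⟩
    x % P           ≡⟨ m<n⇒m%n≡m x<P ⟩
    x ∎
    where open ≡-Reasoning

  digit-/ : ∀ {x} v → x < P → (x + P * v) / P ≡ v
  digit-/ {x} v x<P = begin
    (x + P * v) / P   ≡⟨ cong (λ z → (x + z) / P) (*-comm P v) ⟩
    (x + v * P) / P   ≡⟨ +-distrib-/ x (v * P) (subst (_< P) (sym remainders) x<P) ⟩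
    x / P + v * P / P ≡⟨ cong₂ _+_ (m<n⇒m/n≡0 x<P) (m*n/n≡m v P) ⟩
    v ∎
    where
    open ≡-Reasoning
    remainders : x % P + v * P % P ≡ x
    remainders = trans (cong₂ _+_ (m<n⇒m%n≡m x<P) (m*n%n≡0 v P)) (+-identityʳ x)

  digitSumFuel-fromDigits : ∀ ds fuel → fromDigits P ds ≤ fuel → All (_< P) ds →
                            digitSumFuel b fuel (fromDigits P ds) ≡ sum ds
  digitSumFuel-fromDigits []       fuel _ _ = digitSumFuel-0 fuel
  digitSumFuel-fromDigits (x ∷ xs) fuel n≤fuel (x<P ∷ xs<P) = unfold fuel _ refl n≤fuel
    where
    v : ℕ
    v = fromDigits P xs
    unfold : ∀ fuel n → x + P * v ≡ n → n ≤ fuel → digitSumFuel b fuel n ≡ x + sum xs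
    unfold fuel zero eq _ = begin
      digitSumFuel b fuel 0 ≡⟨ digitSumFuel-0 fuel ⟩
      0                     ≡⟨ sym (fromDigits≡0⇒sum≡0 P (x ∷ xs) eq) ⟩
      x + sum xs ∎
      where open ≡-Reasoning
    unfold (suc f) (suc n) eq n≤fuel = begin
      suc n % P + digitSumFuel b f (suc n / P)
        ≡⟨ cong (λ k → k % P + digitSumFuel b f (k / P)) (sym eq) ⟩
      (x + P * v) % P + digitSumFuel b f ((x + P * v) / P)
        ≡⟨ cong₂ (λ k l → k + digitSumFuel b f l) (digit-% v x<P) (digit-/ v x<P) ⟩
      x + digitSumFuel b f v
        ≡⟨ cong (x +_) (digitSumFuel-fromDigits xs f v≤f xs<P) ⟩
      x + sum xs ∎
      where
      open ≡-Reasoning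
      v≤f : v ≤ f
      v≤f = ≤-pred (≤-trans (subst (_< suc n) quotient (m/n<m (suc n) P (s≤s (s≤s z≤n)))) n≤fuel)
        where
        quotient : suc n / P ≡ v
        quotient = trans (cong (_/ P) (sym eq)) (digit-/ v x<P)

sp-fromDigits : ∀ p → 2 ≤ p → ∀ {ds} → All (_< p) ds → sp p (fromDigits p ds) ≡ sum ds
sp-fromDigits (suc (suc b)) _ {ds} ds<p = digitSumFuel-fromDigits b ds _ ≤-refl ds<p
sp-fromDigits (suc zero) (s≤s ())

fromDigits≢0 : ∀ p .{{_ : NonZero p}} xs → sum xs ≢ 0 → fromDigits p xs ≢ 0
fromDigits≢0 p xs sum≢0 = sum≢0 ∘ fromDigits≡0⇒sum≡0 p xs

fromDigits<max : ∀ p .{{_ : NonZero p}} {xs} → All (_< p) xs → sum xs < length xs * (p ∸ 1) →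
                 fromDigits p xs < p ^ length xs ∸ 1
fromDigits<max p {xs} xs<p sum<max = m+n≤o⇒m≤o∸n (suc F) (begin
  suc F + 1     ≤⟨ +-monoˡ-≤ 1 (+-monoˡ-≤ F (n≢0⇒n>0 (fromDigits≢0 p (map (complement p) xs) complement-sum≢0))) ⟩
  C + F + 1     ≡⟨ fromDigits-complement p xs<p ⟩
  p ^ length xs ∎)
  where
  open ≤-Reasoning
  C F : ℕ
  C = fromDigits p (map (complement p) xs)
  F = fromDigits p xs
  complement-sum≢0 : sum (map (complement p) xs) ≢ 0
  complement-sum≢0 eq = <-irrefl (trans (sym (cong (_+ sum xs) eq)) (sum-complement p xs<p)) sum<max

m+n*k≡o+n*l⇒m%n≡o : ∀ m n k {o l} .{{_ : NonZero n}} → o < n → m + n * k ≡ o + n * l → m % n ≡ o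
m+n*k≡o+n*l⇒m%n≡o m n k {o} {l} o<n eq = begin
  m % n           ≡⟨ sym ([m+kn]%n≡m%n m k n) ⟩
  (m + k * n) % n ≡⟨ cong (λ z → (m + z) % n) (*-comm k n) ⟩
  (m + n * k) % n ≡⟨ cong (_% n) eq ⟩
  (o + n * l) % n ≡⟨ cong (λ z → (o + z) % n) (*-comm n l) ⟩
  (o + l * n) % n ≡⟨ [m+kn]%n≡m%n o l n ⟩
  o % n           ≡⟨ m<n⇒m%n≡m o<n ⟩
  o ∎
  where open ≡-Reasoning

star-≡ : ∀ q e d {N k l} → 0 < N → N < q ∸ 1 → e * d + (q ∸ 1) * k ≡ N + (q ∸ 1) * l → star q e d ≡ N
star-≡ q e d {suc N} {k} _ N<Q cert with q ∸ 1 in q-1≡ | N<Q | cert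
... | suc Q | N<Q' | cert' with e | d | m+n*k≡o+n*l⇒m%n≡o (e * d) (suc Q) k N<Q' cert'
...   | zero  | _     | ed%Q≡N = contradiction ed%Q≡N λ ()
...   | suc e | zero  | ed%Q≡N = contradiction (trans (cong (_% suc Q) (sym (*-zeroʳ (suc e)))) ed%Q≡N) λ ()
...   | suc e | suc d | ed%Q≡N rewrite q-1≡ | ed%Q≡N = refl

odd-prime : ∀ {p} → Prime p → 2 < p → ∃[ h ] p ≡ suc (suc h + suc h)
odd-prime {p} pr 2<p = split (p % 2) (p / 2) (m%n<n p 2) (m≡m%n+[m/n]*n p 2)
  where
  split : ∀ x y → x < 2 → p ≡ x + y * 2 → ∃[ h ] p ≡ suc (suc h + suc h)
  split zero y _ p≡ with prime⇒irreducible pr (divides y p≡)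
  ... | inj₁ ()
  ... | inj₂ 2≡p = contradiction 2≡p (<⇒≢ 2<p)
  split 1 zero _ p≡ = contradiction (sym p≡) (<⇒≢ (<-trans (s≤s (s≤s z≤n)) 2<p))
  split 1 (suc h) _ p≡ = h , trans p≡ (cong suc (double (suc h)))
    where
    double : ∀ n → n * 2 ≡ n + n
    double = solve-∀
  split (suc (suc _)) _ (s≤s (s≤s ())) _

record GapCertificate (p m r d : ℕ) : Set where
  field
    eDigits NDigits : List ℕ
    eDigits<p       : All (_< p) eDigits
    NDigits<p       : All (_< p) NDigits
    length-eDigits  : length eDigits ≤ 2 * m
    length-NDigits  : length NDigits ≡ 2 * m
    sum-eDigits     : sum eDigits ≡ suc r * (p ∸ 1) + 1
    sum-NDigits     : sum NDigits ≡ suc (sum eDigits + m * (p ∸ 1))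
    k l             : ℕ
    congruence      : fromDigits p eDigits * d + (p ^ (2 * m) ∸ 1) * k ≡ fromDigits p NDigits + (p ^ (2 * m) ∸ 1) * l

digit-sum-gap<max : ∀ {P₁ r m} → 3 ≤ P₁ → r + 2 ≤ m → suc (suc r * P₁ + 1 + m * P₁) < 2 * m * P₁
digit-sum-gap<max {P₁} {r} {m} 3≤P₁ r+2≤m = begin-strict
  suc (suc r * P₁ + 1 + m * P₁) <⟨ ≤-reflexive (regroup P₁ r m) ⟩
  suc r * P₁ + 3 + m * P₁       ≤⟨ +-monoˡ-≤ (m * P₁) (+-monoʳ-≤ (suc r * P₁) 3≤P₁) ⟩
  suc r * P₁ + P₁ + m * P₁      ≡⟨ cong (_+ m * P₁) (regroup′ P₁ r) ⟩
  (r + 2) * P₁ + m * P₁         ≤⟨ +-monoˡ-≤ (m * P₁) (*-monoˡ-≤ P₁ r+2≤m) ⟩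
  m * P₁ + m * P₁               ≡⟨ double m P₁ ⟩
  2 * m * P₁ ∎
  where
  open ≤-Reasoning
  regroup : ∀ P₁ r m → suc (suc (suc r * P₁ + 1 + m * P₁)) ≡ suc r * P₁ + 3 + m * P₁
  regroup = solve-∀
  regroup′ : ∀ P₁ r → suc r * P₁ + P₁ ≡ (r + 2) * P₁
  regroup′ = solve-∀
  double : ∀ m P₁ → m * P₁ + m * P₁ ≡ 2 * m * P₁
  double = solve-∀

certificate⇒gap : ∀ {p m r d} → 3 < p → r + 2 ≤ m → GapCertificate p m r d →
  ∃[ e ] (1 ≤ e × e ≤ p ^ (2 * m) ∸ 1 × sp p e + m * (p ∸ 1) < sp p (star (p ^ (2 * m)) e d))
certificate⇒gap {p} {m} {r} {d} 3<p r+2≤m cert = e , 1≤e , e≤q-1 , gap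
  where
  open GapCertificate cert
  instance
    p≢0 : NonZero p
    p≢0 = >-nonZero (<-trans (s≤s z≤n) 3<p)
  2≤p : 2 ≤ p
  2≤p = ≤-trans (s≤s (s≤s z≤n)) (<⇒≤ 3<p)
  q e N : ℕ
  q = p ^ (2 * m)
  e = fromDigits p eDigits
  N = fromDigits p NDigits

  sum-NDigits<max : sum NDigits < length NDigits * (p ∸ 1)
  sum-NDigits<max rewrite sum-NDigits | sum-eDigits | length-NDigits = digit-sum-gap<max (∸-monoˡ-≤ 1 3<p) r+2≤m

  N<q-1 : N < q ∸ 1
  N<q-1 = subst (λ n → N < p ^ n ∸ 1) length-NDigits (fromDigits<max p NDigits<p sum-NDigits<max)

  N>0 : 0 < N
  N>0 = n≢0⇒n>0 (fromDigits≢0 p NDigits (subst (_≢ 0) (sym sum-NDigits) λ ()))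

  star≡N : star q e d ≡ N
  star≡N = star-≡ q e d N>0 N<q-1 congruence

  1≤e : 1 ≤ e
  1≤e = n≢0⇒n>0 λ e≡0 → <⇒≢ N>0 (trans (cong (λ x → star q x d) (sym e≡0)) star≡N)

  e≤q-1 : e ≤ q ∸ 1
  e≤q-1 = <⇒≤pred (<-≤-trans (fromDigits-< p eDigits<p) (^-monoʳ-≤ p length-eDigits))

  gap : sp p e + m * (p ∸ 1) < sp p (star q e d)
  gap rewrite star≡N | sp-fromDigits p 2≤p eDigits<p | sp-fromDigits p 2≤p NDigits<p = ≤-reflexive (sym sum-NDigits)

cancel-square-pred : ∀ {Q M} L R k l → Q + 1 ≡ M * M → L + M * M * k + l ≡ R + M * M * l + k → L + Q * k ≡ R + Q * l
cancel-square-pred {Q} {M} L R k l Q+1≡M² eq = +-cancelʳ-≡ (k + l) _ _ (begin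
  L + Q * k + (k + l)  ≡⟨ expand Q L k l ⟩
  L + (Q + 1) * k + l  ≡⟨ cong (λ z → L + z * k + l) Q+1≡M² ⟩
  L + M * M * k + l    ≡⟨ eq ⟩
  R + M * M * l + k    ≡⟨ cong (λ z → R + z * l + k) (sym Q+1≡M²) ⟩
  R + (Q + 1) * l + k  ≡⟨ sym (expand Q R l k) ⟩
  R + Q * l + (l + k)  ≡⟨ cong (R + Q * l +_) (+-comm l k) ⟩
  R + Q * l + (k + l)  ∎)
  where
  open ≡-Reasoning
  expand : ∀ Q L k l → L + Q * k + (k + l) ≡ L + (Q + 1) * k + l
  expand = solve-∀

-- Modulo M² - 1: (1 + M)·d ≡ 2c(1 + M) because X + Y = c, and M(1 + M) ≡ 1 + M, so with pc = M
-- we get e·d = pa(1 + M)·d - d ≡ 2a(1 + M) - d ≡ N.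
congruence-A : ∀ {p a X Y c M d e N Q} → c ≡ X + Y → M ≡ c * p → d ≡ X + c + M * Y →
               e + 1 ≡ p * a * (1 + M) → N + d + 1 ≡ M * M + 2 * (a + M * a) → Q + 1 ≡ M * M →
               e * d + Q * (p * a * X + 1) ≡ N + Q * (2 * a + p * a * c)
congruence-A {p} {a} {X} {Y} {e = e} {N} refl refl refl e+1≡ N+d+1≡ Q+1≡M² =
  cancel-square-pred {M = M} _ _ _ _ Q+1≡M² (+-cancelʳ-≡ (d + 1) _ _ (begin
    e * d + M * M * k + l + (d + 1)           ≡⟨ regroup e d (M * M * k) l ⟩
    (e + 1) * d + M * M * k + l + 1           ≡⟨ cong (λ z → z * d + M * M * k + l + 1) e+1≡ ⟩
    p * a * (1 + M) * d + M * M * k + l + 1   ≡⟨ identity p a X Y ⟩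
    M * M + 2 * (a + M * a) + M * M * l + k   ≡⟨ cong (λ z → z + M * M * l + k) (sym N+d+1≡) ⟩
    N + d + 1 + M * M * l + k                 ≡⟨ regroup′ N d (M * M * l) k ⟩
    N + M * M * l + k + (d + 1)               ∎))
  where
  open ≡-Reasoning
  c M d k l : ℕ
  c = X + Y
  M = c * p
  d = X + c + M * Y
  k = p * a * X + 1
  l = 2 * a + p * a * c
  regroup : ∀ e d A B → e * d + A + B + (d + 1) ≡ (e + 1) * d + A + B + 1
  regroup = solve-∀
  regroup′ : ∀ N d A B → N + d + 1 + A + B ≡ N + A + B + (d + 1)
  regroup′ = solve-∀
  identity : ∀ p a X Y →
    p * a * (1 + (X + Y) * p) * (X + (X + Y) + (X + Y) * p * Y) + (X + Y) * p * ((X + Y) * p) * (p * a * X + 1) + (2 * a + p * a * (X + Y)) + 1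
      ≡ (X + Y) * p * ((X + Y) * p) + 2 * (a + (X + Y) * p * a) + (X + Y) * p * ((X + Y) * p) * (2 * a + p * a * (X + Y)) + (p * a * X + 1)
  identity = solve-∀

-- Here e = 1 + (1 + M)(h + pα), so modulo M² - 1, e·d ≡ d + 2(1 + M)(ch + Mα) ≡ d + 2(1 + M)A.
congruence-B : ∀ {p X Y c M d h α A e N Q} → c ≡ X + Y → M ≡ c * p → d ≡ X + c + M * Y → A ≡ α + c * h →
               e ≡ suc h + p * α + M * (h + p * α) → N ≡ d + 2 * (A + M * A) → Q + 1 ≡ M * M →
               e * d + Q * (p * A * X + h * d) ≡ N + Q * (2 * A + p * A * c)
congruence-B {p} {X} {Y} {h = h} {α} refl refl refl refl refl refl Q+1≡M² =
  cancel-square-pred {M = (X + Y) * p} _ _ _ _ Q+1≡M² (identity p X Y h α)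
  where
  identity : ∀ p X Y h α →
    let c = X + Y; M = c * p; d = X + c + M * Y; A = α + c * h in
    (suc h + p * α + M * (h + p * α)) * d + M * M * (p * A * X + h * d) + (2 * A + p * A * c)
      ≡ d + 2 * (A + M * A) + M * M * (2 * A + p * A * c) + (p * A * X + h * d)
  identity = solve-∀

module DecompositionOfD (p m s : ℕ) (3<p : 3 < p) (s+2≤m : s + 2 ≤ m)
                        (t : ℕ) (u : Fin s → ℕ) (t<p : t < p) (u<p : ∀ j → u j < p) (1≤t : 1 ≤ t) where
  instance
    p≢0 : NonZero p
    p≢0 = >-nonZero (<-trans (s≤s z≤n) 3<p)

  r a g c M : ℕ
  r = m ∸ 2 ∸ s
  a = p ^ r
  g = p ^ suc s
  c = a * g
  M = c * p

  us ūs Dd : List ℕ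
  us = tabulate u
  ūs = map (complement p) us
  Dd = Ddigits p r t us

  U Ū X Y d Q : ℕ
  U = fromDigits p us
  Ū = fromDigits p ūs
  X = a * (t + p * U)
  Y = a * ((p ∸ t) + p * Ū)
  d = D p r t us
  Q = p ^ (2 * m) ∸ 1

  r+s+2≡m : r + (s + 2) ≡ m
  r+s+2≡m = trans (cong (_+ (s + 2)) (trans (∸-+-assoc m 2 s) (cong (m ∸_) (+-comm 2 s)))) (m∸n+n≡m s+2≤m)

  us<p : All (_< p) us
  us<p = tabulate⁺ u<p

  ūs<p : All (_< p) ūs
  ūs<p = map⁺ (universal (complement<p p) us)

  length-us : length us ≡ s
  length-us = length-tabulate u

  length-ūs : length ūs ≡ s
  length-ūs = trans (length-map (complement p) us) length-us

  Ū+U+1≡p^s : Ū + U + 1 ≡ p ^ s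
  Ū+U+1≡p^s = trans (fromDigits-complement p us<p) (cong (p ^_) length-us)

  sum-ūs+us : sum ūs + sum us ≡ s * (p ∸ 1)
  sum-ūs+us = trans (sum-complement p us<p) (cong (_* (p ∸ 1)) length-us)

  t+[p∸t]≡p : t + (p ∸ t) ≡ p
  t+[p∸t]≡p = m+[n∸m]≡n (<⇒≤ t<p)

  X+Y≡c : X + Y ≡ c
  X+Y≡c = begin
    a * (t + p * U) + a * ((p ∸ t) + p * Ū) ≡⟨ regroup a p t (p ∸ t) U Ū ⟩
    a * ((t + (p ∸ t)) + p * (Ū + U))       ≡⟨ cong (λ z → a * (z + p * (Ū + U))) t+[p∸t]≡p ⟩
    a * (p + p * (Ū + U))                   ≡⟨ cong (a *_) (sym (*-suc p (Ū + U))) ⟩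
    a * (p * suc (Ū + U))                   ≡⟨ cong (λ z → a * (p * z)) (trans (+-comm 1 (Ū + U)) Ū+U+1≡p^s) ⟩
    a * g ∎
    where
    open ≡-Reasoning
    regroup : ∀ a p t t′ U Ū → a * (t + p * U) + a * (t′ + p * Ū) ≡ a * ((t + t′) + p * (Ū + U))
    regroup = solve-∀

  module _ (z x : ℕ) (xs : List ℕ) (w y : ℕ) (ys : List ℕ) (v : ℕ) (length-xs : length xs ≡ s) (length-ys : length ys ≡ s) where

    fromDigits-blocksₛ : fromDigits p (blocks r z x xs w y ys v) ≡
      let Z = fromDigits p (replicate r z) in
      Z + a * ((x + p * fromDigits p xs) + g * ((w + p * Z) + p * a * ((y + p * fromDigits p ys) + g * v)))
    fromDigits-blocksₛ rewrite fromDigits-blocks r z x xs w y ys v p | length-xs | length-ys = refl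

    length-blocksₛ : length (blocks r z x xs w y ys v) ≡ 2 * m
    length-blocksₛ = begin
      length (blocks r z x xs w y ys v)                           ≡⟨ length-blocks r z x xs w y ys v ⟩
      r + (suc (length xs) + (suc r + (suc (length ys) + 1)))    ≡⟨ cong₂ (λ k l → r + (suc k + (suc r + (suc l + 1)))) length-xs length-ys ⟩
      r + (suc s + (suc r + (suc s + 1)))                         ≡⟨ regroup r s ⟩
      (r + (s + 2)) + (r + (s + 2))                               ≡⟨ cong (λ k → k + k) r+s+2≡m ⟩
      m + m                                                       ≡⟨ cong (m +_) (sym (+-identityʳ m)) ⟩
      2 * m ∎
      where
      open ≡-Reasoning
      regroup : ∀ r s → r + (suc s + (suc r + (suc s + 1))) ≡ (r + (s + 2)) + (r + (s + 2))
      regroup = solve-∀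

  d≡X+c+MY : d ≡ X + c + M * Y
  d≡X+c+MY = begin
    d ≡⟨ fromDigits-blocksₛ 0 t us 1 (p ∸ t) ūs 0 length-us length-ūs ⟩
    Z + a * ((t + p * U) + g * ((1 + p * Z) + p * a * (((p ∸ t) + p * Ū) + g * 0))) ≡⟨ cong (λ k → k + a * ((t + p * U) + g * ((1 + p * k) + p * a * (((p ∸ t) + p * Ū) + g * 0)))) (fromDigits-replicate-0 p r) ⟩
    0 + a * ((t + p * U) + g * ((1 + p * 0) + p * a * (((p ∸ t) + p * Ū) + g * 0))) ≡⟨ regroup p a g t (p ∸ t) U Ū ⟩
    X + c + M * Y ∎
    where
    open ≡-Reasoning
    Z : ℕ
    Z = fromDigits p (replicate r 0)
    regroup : ∀ p a g t t′ U Ū → 0 + a * ((t + p * U) + g * ((1 + p * 0) + p * a * ((t′ + p * Ū) + g * 0))) ≡ a * (t + p * U) + a * g + a * g * p * (a * (t′ + p * Ū))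
    regroup = solve-∀

  p^m≡M : p ^ m ≡ M
  p^m≡M = begin
    p ^ m                 ≡⟨ cong (p ^_) (sym r+s+2≡m) ⟩
    p ^ (r + (s + 2))     ≡⟨ ^-distribˡ-+-* p r (s + 2) ⟩
    a * p ^ (s + 2)       ≡⟨ cong (λ k → a * p ^ k) (+-comm s 2) ⟩
    a * (p * g)           ≡⟨ regroup a p g ⟩
    M ∎
    where
    open ≡-Reasoning
    regroup : ∀ a p g → a * (p * g) ≡ a * g * p
    regroup = solve-∀

  q≡M*M : p ^ (2 * m) ≡ M * M
  q≡M*M = begin
    p ^ (m + (m + 0))     ≡⟨ cong (λ k → p ^ (m + k)) (+-identityʳ m) ⟩
    p ^ (m + m)           ≡⟨ ^-distribˡ-+-* p m m ⟩
    p ^ m * p ^ m         ≡⟨ cong₂ _*_ p^m≡M p^m≡M ⟩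
    M * M ∎
    where open ≡-Reasoning

  Q+1≡M*M : Q + 1 ≡ M * M
  Q+1≡M*M = trans (m∸n+n≡m (m^n>0 p (2 * m))) q≡M*M

  0<p : 0 < p
  0<p = <-trans (s≤s z≤n) 3<p

  1<p : 1 < p
  1<p = <-trans (s≤s (s≤s z≤n)) 3<p

  p∸t<p : p ∸ t < p
  p∸t<p = ∸-monoʳ-< 1≤t (<⇒≤ t<p)

  length-Dd : length Dd ≡ 2 * m
  length-Dd = length-blocksₛ 0 t us 1 (p ∸ t) ūs 0 length-us length-ūs

  Dd<p : All (_< p) Dd
  Dd<p = blocks⁺ r 0 t us 1 (p ∸ t) ūs 0 0<p t<p us<p 1<p p∸t<p ūs<p 0<p

module CaseA (p m s : ℕ) (3<p : 3 < p) (s+2≤m : s + 2 ≤ m) (t : ℕ) (u : Fin s → ℕ)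
             (t<p : t < p) (u<p : ∀ j → u j < p) (2≤t : 2 ≤ t) (t+2≤p : t + 2 ≤ p) where
  open DecompositionOfD p m s 3<p s+2≤m t u t<p u<p (≤-trans (s≤s z≤n) 2≤t)

  eDigits CDigits NDigits : List ℕ
  eDigits = replicate (suc r) (p ∸ 1) ++ replicate m 0 ++ (1 ∷ [])
  CDigits = blocks r (p ∸ 1) (complement p t) ūs (complement p 1) (complement p (p ∸ t)) (map (complement p) ūs) (p ∸ 1)
  NDigits = blocks r (p ∸ 1) (complement p t + 2) ūs (complement p 1) (complement p (p ∸ t) + 2) (map (complement p) ūs) (p ∸ 1)

  e C N : ℕ
  e = fromDigits p eDigits
  C = fromDigits p CDigits
  N = fromDigits p NDigits

  fromDigits-0ᵐ1≡M : fromDigits p (replicate m 0 ++ (1 ∷ [])) ≡ M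
  fromDigits-0ᵐ1≡M = begin
    fromDigits p (replicate m 0 ++ (1 ∷ [])) ≡⟨ fromDigits-replicate-0-++ p m (1 ∷ []) ⟩
    p ^ m * (1 + p * 0)                      ≡⟨ cong (λ z → p ^ m * suc z) (*-zeroʳ p) ⟩
    p ^ m * 1                                ≡⟨ *-identityʳ (p ^ m) ⟩
    p ^ m                                    ≡⟨ p^m≡M ⟩
    M ∎
    where open ≡-Reasoning

  e+1≡pa[1+M] : e + 1 ≡ p * a * (1 + M)
  e+1≡pa[1+M] = begin
    e + 1                                        ≡⟨ cong (_+ 1) (fromDigits-++ p (replicate (suc r) (p ∸ 1)) (replicate m 0 ++ (1 ∷ []))) ⟩
    F + p ^ length (replicate (suc r) (p ∸ 1)) * fromDigits p (replicate m 0 ++ (1 ∷ [])) + 1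
                                                 ≡⟨ cong₂ (λ n z → F + p ^ n * z + 1) (length-replicate (suc r)) fromDigits-0ᵐ1≡M ⟩
    F + p * a * M + 1                            ≡⟨ regroup F (p * a * M) ⟩
    (F + 1) + p * a * M                          ≡⟨ cong (_+ p * a * M) (fromDigits-replicate-max p (suc r)) ⟩
    p * a + p * a * M                            ≡⟨ factor (p * a) M ⟩
    p * a * (1 + M) ∎
    where
    open ≡-Reasoning
    F : ℕ
    F = fromDigits p (replicate (suc r) (p ∸ 1))
    regroup : ∀ F B → F + B + 1 ≡ (F + 1) + B
    regroup = solve-∀
    factor : ∀ x M → x + x * M ≡ x * (1 + M)
    factor = solve-∀

  complement-Dd : map (complement p) Dd ≡ CDigits
  complement-Dd = map-blocks r 0 t us 1 (p ∸ t) ūs 0 (complement p)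

  length-map-ūs : length (map (complement p) ūs) ≡ s
  length-map-ūs = trans (length-map (complement p) ūs) length-ūs

  N≡C+2[a+Ma] : N ≡ C + 2 * (a + M * a)
  N≡C+2[a+Ma] = begin
    N                                                   ≡⟨ fromDigits-blocks-bump r (p ∸ 1) (complement p t) ūs (complement p 1) (complement p (p ∸ t)) (map (complement p) ūs) (p ∸ 1) p 2 ⟩
    C + 2 * (a + a * p ^ suc (length ūs) * p ^ suc r)   ≡⟨ cong (λ n → C + 2 * (a + a * p ^ suc n * p ^ suc r)) length-ūs ⟩
    C + 2 * (a + a * g * (p * a))                       ≡⟨ cong (λ z → C + 2 * (a + z)) (regroup a g p) ⟩
    C + 2 * (a + M * a) ∎
    where
    open ≡-Reasoning
    regroup : ∀ a g p → a * g * (p * a) ≡ a * g * p * a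
    regroup = solve-∀

  N+d+1≡M²+2[a+Ma] : N + d + 1 ≡ M * M + 2 * (a + M * a)
  N+d+1≡M²+2[a+Ma] = begin
    N + d + 1                              ≡⟨ cong (λ z → z + d + 1) N≡C+2[a+Ma] ⟩
    C + 2 * (a + M * a) + d + 1            ≡⟨ regroup C (2 * (a + M * a)) d ⟩
    C + d + 1 + 2 * (a + M * a)            ≡⟨ cong (λ z → fromDigits p z + d + 1 + 2 * (a + M * a)) (sym complement-Dd) ⟩
    fromDigits p (map (complement p) Dd) + d + 1 + 2 * (a + M * a)
                                           ≡⟨ cong (_+ 2 * (a + M * a)) (fromDigits-complement p Dd<p) ⟩
    p ^ length Dd + 2 * (a + M * a)        ≡⟨ cong (λ n → p ^ n + 2 * (a + M * a)) length-Dd ⟩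
    p ^ (2 * m) + 2 * (a + M * a)          ≡⟨ cong (_+ 2 * (a + M * a)) q≡M*M ⟩
    M * M + 2 * (a + M * a) ∎
    where
    open ≡-Reasoning
    regroup : ∀ C B d → C + B + d + 1 ≡ C + d + 1 + B
    regroup = solve-∀

  sum-eDigits : sum eDigits ≡ suc r * (p ∸ 1) + 1
  sum-eDigits = begin
    sum eDigits                                                       ≡⟨ sum-++ (replicate (suc r) (p ∸ 1)) _ ⟩
    sum (replicate (suc r) (p ∸ 1)) + sum (replicate m 0 ++ (1 ∷ [])) ≡⟨ cong₂ _+_ (sum-replicate (suc r) (p ∸ 1)) sum-tail ⟩
    suc r * (p ∸ 1) + 1 ∎
    where
    open ≡-Reasoning
    sum-tail : sum (replicate m 0 ++ (1 ∷ [])) ≡ 1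
    sum-tail = trans (sum-++ (replicate m 0) (1 ∷ [])) (cong (_+ 1) (trans (sum-replicate m 0) (*-zeroʳ m)))

  sum-Dd : sum Dd ≡ suc s * (p ∸ 1) + 2
  sum-Dd = begin
    sum Dd                                                               ≡⟨ sum-blocks r 0 t us 1 (p ∸ t) ūs 0 ⟩
    r * 0 + ((t + sum us) + ((1 + r * 0) + ((p ∸ t + sum ūs) + 0)))      ≡⟨ regroup (r * 0) t (p ∸ t) (sum us) (sum ūs) ⟩
    (t + (p ∸ t)) + (sum ūs + sum us) + 1 + (r * 0 + r * 0)              ≡⟨ cong₂ (λ x y → x + y + 1 + (r * 0 + r * 0)) p≡ sum-ūs+us ⟩
    (p ∸ 1 + 1) + s * (p ∸ 1) + 1 + (r * 0 + r * 0)                      ≡⟨ cong (λ z → (p ∸ 1 + 1) + s * (p ∸ 1) + 1 + (z + z)) (*-zeroʳ r) ⟩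
    (p ∸ 1 + 1) + s * (p ∸ 1) + 1 + (0 + 0)                              ≡⟨ regroup′ (p ∸ 1) s ⟩
    suc s * (p ∸ 1) + 2 ∎
    where
    open ≡-Reasoning
    p≡ : t + (p ∸ t) ≡ p ∸ 1 + 1
    p≡ = trans t+[p∸t]≡p (sym (m∸n+n≡m 0<p))
    regroup : ∀ R t t′ U Ū → R + ((t + U) + ((1 + R) + ((t′ + Ū) + 0))) ≡ (t + t′) + (Ū + U) + 1 + (R + R)
    regroup = solve-∀
    regroup′ : ∀ P s → (P + 1) + s * P + 1 + (0 + 0) ≡ suc s * P + 2
    regroup′ = solve-∀

  sum-NDigits≡sum-CDigits+4 : sum NDigits ≡ sum CDigits + 4
  sum-NDigits≡sum-CDigits+4 = sum-blocks-bump r (p ∸ 1) (complement p t) ūs (complement p 1) (complement p (p ∸ t)) (map (complement p) ūs) (p ∸ 1) 2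

  sum-CDigits+sum-Dd : sum CDigits + sum Dd ≡ 2 * m * (p ∸ 1)
  sum-CDigits+sum-Dd = begin
    sum CDigits + sum Dd                    ≡⟨ cong (λ z → sum z + sum Dd) (sym complement-Dd) ⟩
    sum (map (complement p) Dd) + sum Dd    ≡⟨ sum-complement p Dd<p ⟩
    length Dd * (p ∸ 1)                     ≡⟨ cong (_* (p ∸ 1)) length-Dd ⟩
    2 * m * (p ∸ 1) ∎
    where open ≡-Reasoning

  sum-NDigits : sum NDigits ≡ suc (sum eDigits + m * (p ∸ 1))
  sum-NDigits = +-cancelʳ-≡ (sum Dd) _ _ (begin
    sum NDigits + sum Dd                                    ≡⟨ cong (_+ sum Dd) sum-NDigits≡sum-CDigits+4 ⟩
    sum CDigits + 4 + sum Dd                                ≡⟨ xy∙z≈xz∙y (sum CDigits) 4 (sum Dd) ⟩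
    sum CDigits + sum Dd + 4                                ≡⟨ cong (_+ 4) sum-CDigits+sum-Dd ⟩
    2 * m * P₁ + 4                                          ≡⟨ cong (λ k → 2 * k * P₁ + 4) (sym r+s+2≡m) ⟩
    2 * (r + (s + 2)) * P₁ + 4                              ≡⟨ identity r s P₁ ⟩
    suc (suc r * P₁ + 1 + (r + (s + 2)) * P₁) + (suc s * P₁ + 2)
                                                            ≡⟨ cong₂ (λ k l → suc (k + l * P₁) + (suc s * P₁ + 2)) (sym sum-eDigits) r+s+2≡m ⟩
    suc (sum eDigits + m * P₁) + (suc s * P₁ + 2)           ≡⟨ cong (suc (sum eDigits + m * P₁) +_) (sym sum-Dd) ⟩
    suc (sum eDigits + m * P₁) + sum Dd ∎)
    where
    open ≡-Reasoning
    P₁ : ℕ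
    P₁ = p ∸ 1
    identity : ∀ r s P₁ → 2 * (r + (s + 2)) * P₁ + 4 ≡ suc (suc r * P₁ + 1 + (r + (s + 2)) * P₁) + (suc s * P₁ + 2)
    identity = solve-∀

  length-eDigits : length eDigits ≤ 2 * m
  length-eDigits = begin
    length eDigits                                       ≡⟨ length-++ (replicate (suc r) (p ∸ 1)) ⟩
    length (replicate (suc r) (p ∸ 1)) + length (replicate m 0 ++ (1 ∷ []))
                                                         ≡⟨ cong₂ _+_ (length-replicate (suc r)) (trans (length-++ (replicate m 0)) (cong (_+ 1) (length-replicate m))) ⟩
    suc r + (m + 1)                                      ≡⟨ regroup r m ⟩
    (r + 2) + m                                          ≤⟨ +-monoˡ-≤ m (m∸2∸s+2≤m s s+2≤m) ⟩
    m + m                                                ≡⟨ cong (m +_) (sym (+-identityʳ m)) ⟩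
    2 * m ∎
    where
    open ≤-Reasoning
    regroup : ∀ r m → suc r + (m + 1) ≡ (r + 2) + m
    regroup = solve-∀

  certificate : GapCertificate p m r d
  certificate = record
    { eDigits        = eDigits
    ; NDigits        = NDigits
    ; eDigits<p      = ++⁺ (replicate⁺ (suc r) (complement<p p 0)) (++⁺ (replicate⁺ m 0<p) (1<p ∷ []))
    ; NDigits<p      = blocks⁺ r (p ∸ 1) (complement p t + 2) ūs (complement p 1) (complement p (p ∸ t) + 2) (map (complement p) ūs) (p ∸ 1)
                         (complement<p p 0) (complement+2<p 2≤t t<p) ūs<p (complement<p p 1)
                         (complement+2<p (m+n≤o⇒m≤o∸n 2 (subst (_≤ p) (+-comm t 2) t+2≤p)) p∸t<p)
                         (map⁺ (universal (complement<p p) ūs)) (complement<p p 0)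
    ; length-eDigits = length-eDigits
    ; length-NDigits = length-blocksₛ (p ∸ 1) (complement p t + 2) ūs (complement p 1) (complement p (p ∸ t) + 2) (map (complement p) ūs) (p ∸ 1) length-ūs length-map-ūs
    ; sum-eDigits    = sum-eDigits
    ; sum-NDigits    = sum-NDigits
    ; k              = p * a * X + 1
    ; l              = 2 * a + p * a * c
    ; congruence     = congruence-A (sym X+Y≡c) refl d≡X+c+MY e+1≡pa[1+M] N+d+1≡M²+2[a+Ma] Q+1≡M*M
    }

module CaseB (p m s : ℕ) (3<p : 3 < p) (s+2≤m : s + 2 ≤ m) (t : ℕ) (u : Fin s → ℕ)
             (t<p : t < p) (u<p : ∀ j → u j < p) (1≤t : 1 ≤ t)
             (j : Fin s) (2≤uj : 2 ≤ u j) (uj+3≤p : u j + 3 ≤ p) (h : ℕ) (p≡2H+1 : p ≡ suc (suc h + suc h)) where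
  open DecompositionOfD p m s 3<p s+2≤m t u t<p u<p 1≤t

  H : ℕ
  H = suc h

  δs αDigits eDigits T₁ T₂ NDigits : List ℕ
  δs      = tabulate (δ j)
  αDigits = replicate r H ++ (0 ∷ δs)
  eDigits = H ∷ (αDigits ++ (h ∷ αDigits))
  T₁      = tabulate (λ i → u i + 2 * δ j i)
  T₂      = tabulate (λ i → complement p (u i) + 2 * δ j i)
  NDigits = blocks r (H + H) t T₁ (1 + (h + h)) (p ∸ t) T₂ (h + h)

  W Hʳ α A e N : ℕ
  W  = fromDigits p δs
  Hʳ = fromDigits p (replicate r H)
  α  = fromDigits p αDigits
  A  = fromDigits p (αDigits ++ (h ∷ []))
  e  = fromDigits p eDigits
  N  = fromDigits p NDigits

  length-αDigits : length αDigits ≡ r + suc s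
  length-αDigits = trans (length-++ (replicate r H)) (cong₂ (λ k l → k + suc l) (length-replicate r) (length-tabulate (δ j)))

  p^|α|≡c : p ^ length αDigits ≡ c
  p^|α|≡c = trans (cong (p ^_) length-αDigits) (^-distribˡ-+-* p r (suc s))

  α≡ : α ≡ Hʳ + a * (p * W)
  α≡ = trans (fromDigits-++ p (replicate r H) (0 ∷ δs)) (cong (λ n → Hʳ + p ^ n * (p * W)) (length-replicate r))

  A≡ : A ≡ α + c * h
  A≡ = trans (fromDigits-++ p αDigits (h ∷ [])) (cong₂ (λ x y → α + x * y) p^|α|≡c (trans (cong (h +_) (*-zeroʳ p)) (+-identityʳ h)))

  e≡ : e ≡ suc h + p * α + M * (h + p * α)
  e≡ = trans (cong (λ z → H + p * z) (trans (fromDigits-++ p αDigits (h ∷ αDigits)) (cong (λ x → α + x * (h + p * α)) p^|α|≡c)))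
             (regroup p h α c)
    where
    regroup : ∀ p h α c → suc h + p * (α + c * (h + p * α)) ≡ suc h + p * α + c * p * (h + p * α)
    regroup = solve-∀

  length-T₁ : length T₁ ≡ s
  length-T₁ = length-tabulate _

  length-T₂ : length T₂ ≡ s
  length-T₂ = length-tabulate _

  fromDigits-T₁ : fromDigits p T₁ ≡ U + 2 * W
  fromDigits-T₁ = fromDigits-tabulate-+* p u (δ j) 2

  fromDigits-T₂ : fromDigits p T₂ ≡ Ū + 2 * W
  fromDigits-T₂ = trans (fromDigits-tabulate-+* p (complement p ∘ u) (δ j) 2)
                        (cong (λ xs → fromDigits p xs + 2 * W) (sym (map-tabulate u (complement p))))

  N≡d+2[A+MA] : N ≡ d + 2 * (A + M * A)
  N≡d+2[A+MA] = begin
    N ≡⟨ fromDigits-blocksₛ (H + H) t T₁ (1 + (h + h)) (p ∸ t) T₂ (h + h) length-T₁ length-T₂ ⟩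
    Z + a * ((t + p * F₁) + g * ((1 + (h + h) + p * Z) + p * a * ((p ∸ t + p * F₂) + g * (h + h))))
      ≡⟨ cong₂ (λ z f → z + a * ((t + p * f) + g * ((1 + (h + h) + p * z) + p * a * ((p ∸ t + p * F₂) + g * (h + h)))))
               (fromDigits-replicate-+ p r H H) fromDigits-T₁ ⟩
    (Hʳ + Hʳ) + a * ((t + p * (U + 2 * W)) + g * ((1 + (h + h) + p * (Hʳ + Hʳ)) + p * a * ((p ∸ t + p * F₂) + g * (h + h))))
      ≡⟨ cong (λ f → (Hʳ + Hʳ) + a * ((t + p * (U + 2 * W)) + g * ((1 + (h + h) + p * (Hʳ + Hʳ)) + p * a * ((p ∸ t + p * f) + g * (h + h)))))
              fromDigits-T₂ ⟩
    (Hʳ + Hʳ) + a * ((t + p * (U + 2 * W)) + g * ((1 + (h + h) + p * (Hʳ + Hʳ)) + p * a * ((p ∸ t + p * (Ū + 2 * W)) + g * (h + h))))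
      ≡⟨ identity p a g Hʳ t (p ∸ t) U Ū W h ⟩
    (X + c + M * Y) + 2 * (A′ + M * A′)
      ≡⟨ cong₂ (λ x y → x + 2 * (y + M * y)) (sym d≡X+c+MY) (sym (trans A≡ (cong (_+ c * h) α≡))) ⟩
    d + 2 * (A + M * A) ∎
    where
    open ≡-Reasoning
    Z F₁ F₂ A′ : ℕ
    Z = fromDigits p (replicate r (H + H))
    F₁ = fromDigits p T₁
    F₂ = fromDigits p T₂
    A′ = Hʳ + a * (p * W) + c * h
    identity : ∀ p a g Hʳ t t′ U Ū W h →
      (Hʳ + Hʳ) + a * ((t + p * (U + 2 * W)) + g * ((1 + (h + h) + p * (Hʳ + Hʳ)) + p * a * ((t′ + p * (Ū + 2 * W)) + g * (h + h))))
        ≡ (a * (t + p * U) + a * g + a * g * p * (a * (t′ + p * Ū))) + 2 * ((Hʳ + a * (p * W) + a * g * h) + a * g * p * (Hʳ + a * (p * W) + a * g * h))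
    identity = solve-∀

  p∸1≡H+H : p ∸ 1 ≡ H + H
  p∸1≡H+H = cong (_∸ 1) p≡2H+1

  ≤H+H⇒<p : ∀ {x} → x ≤ H + H → x < p
  ≤H+H⇒<p {x} x≤ = subst (x <_) (sym p≡2H+1) (s≤s x≤)

  2h+1≤H+H : 1 + (h + h) ≤ H + H
  2h+1≤H+H = s≤s (+-monoʳ-≤ h (n≤1+n h))

  αDigits<p : All (_< p) αDigits
  αDigits<p = ++⁺ (replicate⁺ r (≤H+H⇒<p (m≤m+n H H))) (0<p ∷ tabulate⁺ (λ i → ≤-<-trans (δ≤1 j i) 1<p))

  eDigits<p : All (_< p) eDigits
  eDigits<p = ≤H+H⇒<p (m≤m+n H H) ∷ ++⁺ αDigits<p (≤H+H⇒<p (≤-trans (n≤1+n h) (m≤m+n H H)) ∷ αDigits<p)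

  NDigits<p : All (_< p) NDigits
  NDigits<p = blocks⁺ r (H + H) t T₁ (1 + (h + h)) (p ∸ t) T₂ (h + h)
    (≤H+H⇒<p ≤-refl) t<p (tabulate⁺ (λ i → +2δ<p u j i (u<p i) uj+2<p))
    (≤H+H⇒<p 2h+1≤H+H) p∸t<p
    (tabulate⁺ (λ i → +2δ<p (complement p ∘ u) j i (complement<p p (u i)) (complement+2<p 2≤uj (u<p j))))
    (≤H+H⇒<p (≤-trans (n≤1+n (h + h)) 2h+1≤H+H))
    where
    uj+2<p : u j + 2 < p
    uj+2<p = subst (_≤ p) (+-suc (u j) 2) uj+3≤p

  length-eDigits : length eDigits ≡ 2 * m
  length-eDigits = begin
    suc (length (αDigits ++ (h ∷ αDigits)))         ≡⟨ cong suc (length-++ αDigits) ⟩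
    suc (length αDigits + suc (length αDigits))     ≡⟨ cong (λ n → suc (n + suc n)) length-αDigits ⟩
    suc (r + suc s + suc (r + suc s))               ≡⟨ regroup r s ⟩
    2 * (r + (s + 2))                               ≡⟨ cong (2 *_) r+s+2≡m ⟩
    2 * m ∎
    where
    open ≡-Reasoning
    regroup : ∀ r s → suc (r + suc s + suc (r + suc s)) ≡ 2 * (r + (s + 2))
    regroup = solve-∀

  sum-αDigits : sum αDigits ≡ r * H + 1
  sum-αDigits = trans (sum-++ (replicate r H) (0 ∷ δs)) (cong₂ _+_ (sum-replicate r H) (sum-tabulate-δ j))

  sum-eDigits : sum eDigits ≡ suc r * (p ∸ 1) + 1
  sum-eDigits = begin
    H + sum (αDigits ++ (h ∷ αDigits))          ≡⟨ cong (H +_) (sum-++ αDigits (h ∷ αDigits)) ⟩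
    H + (sum αDigits + (h + sum αDigits))       ≡⟨ cong (λ x → H + (x + (h + x))) sum-αDigits ⟩
    H + ((r * H + 1) + (h + (r * H + 1)))       ≡⟨ regroup r h ⟩
    suc r * (H + H) + 1                         ≡⟨ cong (λ x → suc r * x + 1) (sym p∸1≡H+H) ⟩
    suc r * (p ∸ 1) + 1 ∎
    where
    open ≡-Reasoning
    regroup : ∀ r h → suc h + ((r * suc h + 1) + (h + (r * suc h + 1))) ≡ suc r * (suc h + suc h) + 1
    regroup = solve-∀

  sum-T₁ : sum T₁ ≡ sum us + 2
  sum-T₁ = trans (sum-tabulate-+* u (δ j) 2) (cong (λ x → sum us + 2 * x) (sum-tabulate-δ j))

  sum-T₂ : sum T₂ ≡ sum ūs + 2
  sum-T₂ = trans (sum-tabulate-+* (complement p ∘ u) (δ j) 2)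
                 (cong₂ (λ xs x → sum xs + 2 * x) (sym (map-tabulate u (complement p))) (sum-tabulate-δ j))

  sum-NDigits : sum NDigits ≡ suc (sum eDigits + m * (p ∸ 1))
  sum-NDigits = begin
    sum NDigits
      ≡⟨ sum-blocks r (H + H) t T₁ (1 + (h + h)) (p ∸ t) T₂ (h + h) ⟩
    r * (H + H) + ((t + sum T₁) + ((1 + (h + h) + r * (H + H)) + ((p ∸ t + sum T₂) + (h + h))))
      ≡⟨ cong₂ (λ x y → r * (H + H) + ((t + x) + ((1 + (h + h) + r * (H + H)) + ((p ∸ t + y) + (h + h))))) sum-T₁ sum-T₂ ⟩
    r * (H + H) + ((t + (sum us + 2)) + ((1 + (h + h) + r * (H + H)) + ((p ∸ t + (sum ūs + 2)) + (h + h))))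
      ≡⟨ regroup (r * (H + H)) t (p ∸ t) (sum us) (sum ūs) h ⟩
    (t + (p ∸ t)) + (sum ūs + sum us) + (r * (H + H) + r * (H + H) + (h + h) + (h + h) + 5)
      ≡⟨ cong₂ (λ x y → x + y + (r * (H + H) + r * (H + H) + (h + h) + (h + h) + 5)) (trans t+[p∸t]≡p p≡2H+1) (trans sum-ūs+us (cong (s *_) p∸1≡H+H)) ⟩
    suc (H + H) + s * (H + H) + (r * (H + H) + r * (H + H) + (h + h) + (h + h) + 5)
      ≡⟨ identity r s h ⟩
    suc (suc r * (H + H) + 1 + (r + (s + 2)) * (H + H))
      ≡⟨ cong₂ (λ x k → suc (x + k * (H + H))) (sym (trans sum-eDigits (cong (λ x → suc r * x + 1) p∸1≡H+H))) r+s+2≡m ⟩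
    suc (sum eDigits + m * (H + H))
      ≡⟨ cong (λ x → suc (sum eDigits + m * x)) (sym p∸1≡H+H) ⟩
    suc (sum eDigits + m * (p ∸ 1)) ∎
    where
    open ≡-Reasoning
    regroup : ∀ R t t′ U Ū h → R + ((t + (U + 2)) + ((1 + (h + h) + R) + ((t′ + (Ū + 2)) + (h + h))))
                              ≡ (t + t′) + (Ū + U) + (R + R + (h + h) + (h + h) + 5)
    regroup = solve-∀
    identity : ∀ r s h → suc (suc h + suc h) + s * (suc h + suc h) + (r * (suc h + suc h) + r * (suc h + suc h) + (h + h) + (h + h) + 5)
                         ≡ suc (suc r * (suc h + suc h) + 1 + (r + (s + 2)) * (suc h + suc h))
    identity = solve-∀

  certificate : GapCertificate p m r d
  certificate = record
    { eDigits        = eDigits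
    ; NDigits        = NDigits
    ; eDigits<p      = eDigits<p
    ; NDigits<p      = NDigits<p
    ; length-eDigits = ≤-reflexive length-eDigits
    ; length-NDigits = length-blocksₛ (H + H) t T₁ (1 + (h + h)) (p ∸ t) T₂ (h + h) length-T₁ length-T₂
    ; sum-eDigits    = sum-eDigits
    ; sum-NDigits    = sum-NDigits
    ; k              = p * A * X + h * d
    ; l              = 2 * A + p * A * c
    ; congruence     = congruence-B (sym X+Y≡c) refl d≡X+c+MY A≡ e≡ N≡d+2[A+MA] Q+1≡M*M
    }

lemma7 : (p m s : ℕ) → Prime p → 3 < p → 2 ≤ m → s + 2 ≤ m →
         (t : ℕ) (u : Fin s → ℕ) → t < p → (∀ j → u j < p) → t ≢ 0 →
         ((t ≢ 1 × t ≢ p ∸ 1) ⊎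
          (∃[ j ] (u j ≢ 0 × u j ≢ 1 × u j ≢ p ∸ 2 × u j ≢ p ∸ 1))) →
         ∃[ e ] (1 ≤ e × e ≤ p ^ (2 * m) ∸ 1 ×
           sp p e + m * (p ∸ 1) <
             sp p (star (p ^ (2 * m)) e (D p (m ∸ 2 ∸ s) t (tabulate u))))
-- The hypothesis 2 ≤ m is implied by s + 2 ≤ m.
lemma7 p m s _ 3<p _ s+2≤m t u t<p u<p t≢0 (inj₁ (t≢1 , t≢p∸1)) =
  certificate⇒gap 3<p (m∸2∸s+2≤m s s+2≤m) (CaseA.certificate p m s 3<p s+2≤m t u t<p u<p (x≢0∧x≢1⇒2≤x t≢0 t≢1) t+2≤p)
  where
  t+2≤p : t + 2 ≤ p
  t+2≤p = x+[1+k]≤p 1 (subst (_≤ p) (+-comm 1 t) t<p) t≢p∸1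
lemma7 p m s p-prime 3<p _ s+2≤m t u t<p u<p t≢0 (inj₂ (j , uj≢0 , uj≢1 , uj≢p∸2 , uj≢p∸1))
  with odd-prime p-prime (<-trans (n<1+n 2) 3<p)
... | h , p≡2H+1 =
  certificate⇒gap 3<p (m∸2∸s+2≤m s s+2≤m)
    (CaseB.certificate p m s 3<p s+2≤m t u t<p u<p (n≢0⇒n>0 t≢0) j (x≢0∧x≢1⇒2≤x uj≢0 uj≢1) uj+3≤p h p≡2H+1)
  where
  uj+3≤p : u j + 3 ≤ p
  uj+3≤p = x+[1+k]≤p 2 (x+[1+k]≤p 1 (subst (_≤ p) (+-comm 1 (u j)) (u<p j)) uj≢p∸1) uj≢p∸2
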